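{- Let $G=(V,E)$ be an AT-free graph, let $u$ be the last vertex visited during some LexBFS of $G$, let $\sigma=LexBFS(u)$, and let $v=\sigma(1)$ be the last vertex visited during $LexBFS(u)$. Let $x,y\in V$ be such that $xy\notin E$, $dist(v,x)=dist(v,y)=i$ and $\sigma^{ -1}(x)<\sigma^{ -1}(y)$. Then for every $z\in V$ with $dist(v,z)>i$ we have $dist(y,z)\leq\max\{dist(x,z),2\}$.
   Context: Graphs are finite, simple and connected. A graph is AT-free if there are no three vertices such that between any two there is a path avoiding the closed neighbourhood of the third. LexBFS started at $s$: every vertex keeps a label (sequence of integers, initially empty); for $j=1,\dots,n$ choose an unvisited vertex with lexicographically largest label (ties arbitrary; first choice $s$), number it $n-j+1$, and append $n-j+1$ to labels of its unvisited neighbours. The output $\sigma=LexBFS(s)$ is this numbering: $\sigma(i)$ is the vertex numbered $i$ and $\sigma^{ -1}(x)$ the number of $x$; thus $\sigma(1)$ is the last visited vertex. -}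

module Defs where

open import Data.Nat using (ℕ; zero; suc; _∸_; _<_; _≤_; _<ᵇ_)
open import Data.Bool using (Bool; true; false; T; _∧_; if_then_else_)
open import Data.Fin using (Fin; toℕ; fromℕ)
open import Data.Fin.Permutation using (Permutation′; _⟨$⟩ʳ_; _⟨$⟩ˡ_)
open import Data.List using (List; []; _∷_)
open import Data.List.Base using (allFin)
open import Data.List.Relation.Binary.Lex.Core using (Lex-<)
open import Data.Product using (Σ; _×_; _,_; ∃)
open import Relation.Binary.PropositionalEquality using (_≡_)
open import Relation.Nullary using (¬_)

module _ {n : ℕ} (adj : Fin n → Fin n → Bool) where

  E : Fin n → Fin n → Set
  E a b = T (adj a b)

  data Walk : Fin n → Fin n → ℕ → Set where
    here : ∀ {a} → Walk a a 0
    step : ∀ {a c b k} → E a c → Walk c b k → Walk a b (suc k)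

  IsDist : Fin n → Fin n → ℕ → Set
  IsDist a b d = Walk a b d × (∀ k → Walk a b k → d ≤ k)

  data AvoidWalk (w : Fin n) : Fin n → Fin n → Set where
    here : ∀ {a} → ¬ (a ≡ w) → ¬ E w a → AvoidWalk w a a
    step : ∀ {a c b} → ¬ (a ≡ w) → ¬ E w a → E a c → AvoidWalk w c b → AvoidWalk w a b

  AsteroidalTriple : Fin n → Fin n → Fin n → Set
  AsteroidalTriple a b c = AvoidWalk c a b × AvoidWalk a b c × AvoidWalk b a c

  ATFree : Set
  ATFree = ∀ a b c → ¬ AsteroidalTriple a b c

  -- A visiting order τ : step (0-based) ↦ vertex.  τ at step k gets number n ∸ k
  -- (i.e. n-j+1 for the 1-based step j).
  -- label τ j w : label of w just before step j (numbers of visited neighbours,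
  -- in order of appending).
  labelFrom : Permutation′ n → Fin n → Fin n → List (Fin n) → List ℕ
  labelFrom τ j w [] = []
  labelFrom τ j w (k ∷ ks) =
    if (toℕ k <ᵇ toℕ j) ∧ adj (τ ⟨$⟩ʳ k) w
    then (n ∸ toℕ k) ∷ labelFrom τ j w ks
    else labelFrom τ j w ks

  label : Permutation′ n → Fin n → Fin n → List ℕ
  label τ j w = labelFrom τ j w (allFin n)

  _<lex_ : List ℕ → List ℕ → Set
  xs <lex ys = Lex-< _≡_ _<_ xs ys

  IsLexBFS : (s : Fin n) → Permutation′ n → Set
  IsLexBFS s τ =
    (∀ (j : Fin n) → toℕ j ≡ 0 → τ ⟨$⟩ʳ j ≡ s) ×
    (∀ (j m : Fin n) → toℕ j < toℕ m →
       ¬ (label τ j (τ ⟨$⟩ʳ j) <lex label τ j (τ ⟨$⟩ʳ m)))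

  -- σ⁻¹(x): the LexBFS number of x, σ⁻¹(x) = n - (0-based visit step of x)
  σ⁻¹ : Permutation′ n → Fin n → ℕ
  σ⁻¹ τ x = n ∸ toℕ (τ ⟨$⟩ˡ x)

record Graph (n : ℕ) : Set where
  field
    adj       : Fin n → Fin n → Bool
    sym       : ∀ a b → adj a b ≡ adj b a
    irref     : ∀ a → adj a a ≡ false
    connected : ∀ a b → ∃ λ k → Walk adj a b k

module Submission where

-- The four-point condition of LexBFS (a < b < c, ac ∈ E, ab ∉ E force some d < a with db ∈ E,
-- dc ∉ E) together with AT-freeness makes u admissible: no a, b such that a reaches u avoiding N[b]
-- and b reaches u avoiding N[a].  Starting σ at an admissible vertex, every vertex of the component
-- of u in G − N[y] is visited before y; otherwise a shortest and then lightest route from u leaving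
-- that set is shortened or lightened, again by the four-point condition.
-- Now suppose dist(y,z) > max(dist(x,z), 2).  A shortest x–z path avoids N[y], so N[z] misses the
-- component of u in G − N[y], which cannot contain x as σ visits x after y.  As N[y] and N[z] are
-- disjoint, u reaches y avoiding N[z], and so does v along a shortest v–y path since
-- dist(v,z) > i.  Hence σ visits v before z, although v comes last.

open import Defs
open import Data.Bool using (Bool; true; false; T; _∧_)
open import Data.Bool.Properties using (T-∧)
open import Data.Empty using (⊥; ⊥-elim)
open import Data.Fin using (Fin; toℕ; fromℕ; fromℕ<; zero; suc)
open import Data.Fin.Permutation using (Permutation′; _⟨$⟩ʳ_; _⟨$⟩ˡ_; inverseˡ; inverseʳ)
open import Data.Fin.Properties using (_≟_; toℕ<n; toℕ-injective; toℕ-fromℕ; toℕ-fromℕ<; any?)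
open import Data.List using (List; []; _∷_; tabulate; allFin)
open import Data.List.Membership.Propositional using (_∈_)
open import Data.List.Membership.Propositional.Properties using (∈-allFin)
open import Data.List.Relation.Binary.Lex.Core using (halt; this; next)
open import Data.List.Relation.Unary.Any using (here; there)
open import Data.Nat using (ℕ; zero; suc; _+_; _∸_; _<_; _≤_; _<ᵇ_; _⊔_; z≤n; s≤s; s≤s⁻¹; z<s; _<?_; _≤?_)
  renaming (_≟_ to _≟ℕ_)
open import Data.Nat.Induction using (<-wellFounded)
open import Data.Nat.Properties hiding (_≟_)
open import Data.Product using (_×_; _,_; ∃; proj₁; proj₂)
open import Data.Sum using (_⊎_; inj₁; inj₂; [_,_]′)
open import Function using (_∘_; id)
open import Function.Bundles using (Equivalence)
open import Induction.WellFounded using (module All)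
open import Level using (0ℓ)
open import Relation.Binary.Definitions using (tri<; tri≈; tri>)
open import Relation.Binary.PropositionalEquality
import Relation.Binary.Construct.On as On
open import Relation.Nullary using (¬_; Dec; yes; no; ¬?)
open import Relation.Nullary.Decidable using (_×-dec_; T?)

measure-rec : ∀ {A : Set} (f : A → ℕ) (P : A → Set) →
  (∀ x → (∀ y → f y < f x → P y) → P x) → ∀ x → P x
measure-rec f P ind = All.wfRec (On.wellFounded f <-wellFounded) 0ℓ P λ x smaller → ind x λ y → smaller

no-minimal-counterexample : ∀ {A : Set} (f : A → ℕ) (P : A → Set) →
  (∀ x → P x → (∀ y → f y < f x → ¬ P y) → ⊥) → ∀ x → ¬ P x
no-minimal-counterexample f P minimal = measure-rec f (¬_ ∘ P) λ x smaller px → minimal x px smaller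

bounded-all-or-any : ∀ (P Q : ℕ → Set) → (∀ k → P k ⊎ Q k) →
  ∀ i → (∀ k → k ≤ i → P k) ⊎ ∃ λ k → k ≤ i × Q k
bounded-all-or-any P Q P⊎Q zero with P⊎Q 0
... | inj₁ p = inj₁ λ { .0 z≤n → p }
... | inj₂ q = inj₂ (0 , z≤n , q)
bounded-all-or-any P Q P⊎Q (suc i) with bounded-all-or-any P Q P⊎Q i | P⊎Q (suc i)
... | inj₂ (k , k≤i , q) | _     = inj₂ (k , m≤n⇒m≤1+n k≤i , q)
... | inj₁ all         | inj₂ q = inj₂ (suc i , ≤-refl , q)
... | inj₁ all         | inj₁ p = inj₁ λ k k≤1+i → [ (λ k≤i → all k (≤-pred k≤i)) , (λ { refl → p }) ]′
                                                     (m≤n⇒m<n∨m≡n k≤1+i)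

sum≤ : (ℕ → ℕ) → ℕ → ℕ
sum≤ g zero    = g 0
sum≤ g (suc m) = sum≤ g m + g (suc m)

sum≤-mono-≤ : ∀ {g h} m → (∀ k → k ≤ m → g k ≤ h k) → sum≤ g m ≤ sum≤ h m
sum≤-mono-≤ zero    g≤h = g≤h 0 z≤n
sum≤-mono-≤ (suc m) g≤h = +-mono-≤ (sum≤-mono-≤ m (λ k → g≤h k ∘ m≤n⇒m≤1+n)) (g≤h (suc m) ≤-refl)

sum≤-mono-< : ∀ {g h j} m → (∀ k → k ≤ m → g k ≤ h k) → j ≤ m → g j < h j → sum≤ g m < sum≤ h m
sum≤-mono-< zero    g≤h z≤n   gj<hj = gj<hj
sum≤-mono-< (suc m) g≤h j≤1+m gj<hj with m≤n⇒m<n∨m≡n j≤1+m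
... | inj₂ refl = +-mono-≤-< (sum≤-mono-≤ m (λ k → g≤h k ∘ m≤n⇒m≤1+n)) gj<hj
... | inj₁ j≤m  =
  +-mono-<-≤ (sum≤-mono-< m (λ k → g≤h k ∘ m≤n⇒m≤1+n) (≤-pred j≤m) gj<hj) (g≤h (suc m) ≤-refl)

-- skip i d drops the d positions after i
skip : ℕ → ℕ → ℕ → ℕ
skip i d k with k ≤? i
... | yes _ = k
... | no  _ = k + d

skip-≤ : ∀ {i d k} → k ≤ i → skip i d k ≡ k
skip-≤ {i} {d} {k} k≤i with k ≤? i
... | yes _   = refl
... | no  k≰i = ⊥-elim (k≰i k≤i)

skip-> : ∀ {i d k} → i < k → skip i d k ≡ k + d
skip-> {i} {d} {k} i<k with k ≤? i
... | yes k≤i = ⊥-elim (<⇒≱ i<k k≤i)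
... | no  _   = refl

skip-≤-+ : ∀ i d k → skip i d k ≤ k + d
skip-≤-+ i d k with k ≤? i
... | yes _ = m≤m+n k d
... | no  _ = ≤-refl

skip-0 : ∀ i k → skip i 0 k ≡ k
skip-0 i k with k ≤? i
... | yes _ = refl
... | no  _ = +-identityʳ k

infixl 6 _[_↦_]

_[_↦_] : ∀ {A : Set} → (ℕ → A) → ℕ → A → ℕ → A
(r [ j ↦ a ]) k with k ≟ℕ j
... | yes _ = a
... | no  _ = r k

update-≡ : ∀ {A : Set} (r : ℕ → A) j {a} → (r [ j ↦ a ]) j ≡ a
update-≡ r j with j ≟ℕ j
... | yes _   = refl
... | no  j≢j = ⊥-elim (j≢j refl)

update-≢ : ∀ {A : Set} (r : ℕ → A) {j a k} → ¬ k ≡ j → (r [ j ↦ a ]) k ≡ r k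
update-≢ r {j} {k = k} k≢j with k ≟ℕ j
... | yes k≡j = ⊥-elim (k≢j k≡j)
... | no  _   = refl

update-elim : ∀ {A : Set} {P : A → Set} (r : ℕ → A) {j a} k →
  (¬ k ≡ j → P (r k)) → P a → P ((r [ j ↦ a ]) k)
update-elim r {j} k Pr Pa with k ≟ℕ j
... | yes _   = Pa
... | no  k≢j = Pr k≢j

update-∀≤ : ∀ {A : Set} {P : A → Set} {r : ℕ → A} {m a} →
  (∀ k → k ≤ m → P (r k)) → P a → ∀ k → k ≤ suc m → P ((r [ suc m ↦ a ]) k)
update-∀≤ {P = P} {r} all Pa k k≤1+m =
  update-elim {P = P} r k (λ k≢ → all k (≤-pred (≤∧≢⇒< k≤1+m k≢))) Pa

-- LexBFS labels and the four-point condition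

data Ascending {m : ℕ} : ℕ → List (Fin m) → Set where
  []  : ∀ {lo} → Ascending lo []
  _∷_ : ∀ {lo k ks} → lo ≤ toℕ k → Ascending (suc (toℕ k)) ks → Ascending lo (k ∷ ks)

Ascending-weaken : ∀ {m lo lo′} {ks : List (Fin m)} → lo ≤ lo′ → Ascending lo′ ks → Ascending lo ks
Ascending-weaken lo≤lo′ []         = []
Ascending-weaken lo≤lo′ (le ∷ asc) = ≤-trans lo≤lo′ le ∷ asc

Ascending-∈ : ∀ {m lo k} {ks : List (Fin m)} → Ascending lo ks → k ∈ ks → lo ≤ toℕ k
Ascending-∈ (le ∷ asc) (here refl) = le
Ascending-∈ (le ∷ asc) (there k∈)  = ≤-trans (m≤n⇒m≤1+n le) (Ascending-∈ asc k∈)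

tabulate-Ascending : ∀ {m p} lo (f : Fin p → Fin m) → (∀ i → toℕ (f i) ≡ lo + toℕ i) →
                     Ascending lo (tabulate f)
tabulate-Ascending {p = zero}  lo f f≡ = []
tabulate-Ascending {p = suc p} lo f f≡ =
  ≤-reflexive (sym f0≡) ∷ Ascending-weaken (≤-reflexive (cong suc f0≡))
    (tabulate-Ascending (suc lo) (f ∘ suc) λ i → trans (f≡ (suc i)) (+-suc lo (toℕ i)))
  where f0≡ = trans (f≡ zero) (+-identityʳ lo)

allFin-Ascending : ∀ m → Ascending 0 (allFin m)
allFin-Ascending m = tabulate-Ascending 0 id λ _ → refl

module LabelOrder {n : ℕ} (adj : Fin n → Fin n → Bool) (τ : Permutation′ n) where

  _≺_ : List ℕ → List ℕ → Set
  _≺_ = _<lex_ adj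

  counts : Fin n → Fin n → Fin n → Bool
  counts j w k = (toℕ k <ᵇ toℕ j) ∧ adj (τ ⟨$⟩ʳ k) w

  labelFrom-counted : ∀ {j w k} ks → T (counts j w k) →
                      labelFrom adj τ j w (k ∷ ks) ≡ (n ∸ toℕ k) ∷ labelFrom adj τ j w ks
  labelFrom-counted {j} {w} {k} ks c with counts j w k
  ... | true = refl

  labelFrom-uncounted : ∀ {j w k} ks → ¬ T (counts j w k) →
                        labelFrom adj τ j w (k ∷ ks) ≡ labelFrom adj τ j w ks
  labelFrom-uncounted {j} {w} {k} ks ¬c with counts j w k
  ... | true  = ⊥-elim (¬c _)
  ... | false = refl

  labelFrom-<lex-∷ : ∀ {t} ks → Ascending (suc t) ks → ∀ j w xs →
                     labelFrom adj τ j w ks ≺ ((n ∸ t) ∷ xs)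
  labelFrom-<lex-∷ []       []         j w xs = halt
  labelFrom-<lex-∷ (k ∷ ks) (t<k ∷ asc) j w xs with T? (counts j w k)
  ... | yes c = subst (_≺ _) (sym (labelFrom-counted ks c)) (this (∸-monoʳ-< t<k (<⇒≤ (toℕ<n k))))
  ... | no ¬c = subst (_≺ _) (sym (labelFrom-uncounted ks ¬c))
                  (labelFrom-<lex-∷ ks (Ascending-weaken (m≤n⇒m≤1+n t<k) asc) j w xs)

  module _ (j B C ja : Fin n)
           (earlier : ∀ k → toℕ k < toℕ ja → T (counts j B k) → T (counts j C k))
           (¬Bja : ¬ T (counts j B ja)) (Cja : T (counts j C ja)) where

    labelFrom-≺ : ∀ {lo} ks → Ascending lo ks → ja ∈ ks → labelFrom adj τ j B ks ≺ labelFrom adj τ j C ks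
    labelFrom-≺ (k ∷ ks) (_ ∷ asc) (here refl) =
      subst₂ _≺_ (sym (labelFrom-uncounted ks ¬Bja)) (sym (labelFrom-counted ks Cja))
        (labelFrom-<lex-∷ ks asc j B _)
    labelFrom-≺ (k ∷ ks) (_ ∷ asc) (there ja∈) with T? (counts j B k) | T? (counts j C k)
    ... | yes b | yes c = subst₂ _≺_ (sym (labelFrom-counted ks b)) (sym (labelFrom-counted ks c))
                            (next refl (labelFrom-≺ ks asc ja∈))
    ... | no ¬b | no ¬c = subst₂ _≺_ (sym (labelFrom-uncounted ks ¬b)) (sym (labelFrom-uncounted ks ¬c))
                            (labelFrom-≺ ks asc ja∈)
    ... | no ¬b | yes c = subst₂ _≺_ (sym (labelFrom-uncounted ks ¬b)) (sym (labelFrom-counted ks c))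
                            (labelFrom-<lex-∷ ks asc j B _)
    ... | yes b | no ¬c = ⊥-elim (¬c (earlier k (Ascending-∈ asc ja∈) b))

  Separating : Fin n → Fin n → Fin n → Set
  Separating ja b c = ∃ λ k → toℕ k < toℕ ja × E adj (τ ⟨$⟩ʳ k) b × ¬ E adj (τ ⟨$⟩ʳ k) c

  separating? : ∀ ja b c → Dec (Separating ja b c)
  separating? ja b c =
    any? λ k → (toℕ k <? toℕ ja) ×-dec T? (adj (τ ⟨$⟩ʳ k) b) ×-dec ¬? (T? (adj (τ ⟨$⟩ʳ k) c))

  -- The vertex chosen at step jb does not have a smaller label than the one chosen at jc,
  -- so if step ja sees the latter but not the former, an earlier step separates them the other way.
  lexBFS-fourPoint-steps : ∀ {s} → IsLexBFS adj s τ → ∀ (ja jb jc : Fin n) →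
    toℕ ja < toℕ jb → toℕ jb < toℕ jc →
    E adj (τ ⟨$⟩ʳ ja) (τ ⟨$⟩ʳ jc) → ¬ E adj (τ ⟨$⟩ʳ ja) (τ ⟨$⟩ʳ jb) →
    Separating ja (τ ⟨$⟩ʳ jb) (τ ⟨$⟩ʳ jc)
  lexBFS-fourPoint-steps lexBFS ja jb jc a<b b<c ac ¬ab with separating? ja (τ ⟨$⟩ʳ jb) (τ ⟨$⟩ʳ jc)
  ... | yes sep = sep
  ... | no ¬sep = ⊥-elim (proj₂ lexBFS jb jc b<c
                    (labelFrom-≺ jb (τ ⟨$⟩ʳ jb) (τ ⟨$⟩ʳ jc) ja earlier
                       (¬ab ∘ proj₂ ∘ to T-∧) (from T-∧ (<⇒<ᵇ a<b , ac))
                       (allFin n) (allFin-Ascending n) (∈-allFin ja)))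
    where
    open Equivalence
    earlier : ∀ k → toℕ k < toℕ ja → T (counts jb (τ ⟨$⟩ʳ jb) k) → T (counts jb (τ ⟨$⟩ʳ jc) k)
    earlier k k<a kB with T? (adj (τ ⟨$⟩ʳ k) (τ ⟨$⟩ʳ jc))
    ... | yes kc = from T-∧ (proj₁ (to T-∧ kB) , kc)
    ... | no ¬kc = ⊥-elim (¬sep (k , k<a , proj₂ (to T-∧ kB) , ¬kc))

-- Walks and closed neighbourhoods

module GraphFacts {n : ℕ} (G : Graph n) where
  open Graph G renaming (sym to adj-sym)

  infix 4 _~_ _~?_ _∉N[_] _∈N[_]

  _~_ : Fin n → Fin n → Set
  _~_ = E adj

  _~?_ : ∀ a b → Dec (a ~ b)
  a ~? b = T? (adj a b)

  _∉N[_] : Fin n → Fin n → Set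
  a ∉N[ w ] = ¬ a ≡ w × ¬ w ~ a

  ~-sym : ∀ {a b} → a ~ b → b ~ a
  ~-sym {a} {b} = subst T (adj-sym a b)

  ~-irrefl : ∀ {a} → ¬ a ~ a
  ~-irrefl {a} = subst T (irref a)

  _∈N[_] : Fin n → Fin n → Set
  a ∈N[ w ] = a ≡ w ⊎ w ~ a

  ∉N-or-∈N : ∀ a w → a ∉N[ w ] ⊎ a ∈N[ w ]
  ∉N-or-∈N a w with a ≟ w | w ~? a
  ... | yes a≡w | _       = inj₂ (inj₁ a≡w)
  ... | no _    | yes w~a = inj₂ (inj₂ w~a)
  ... | no a≢w  | no ¬w~a = inj₁ (a≢w , ¬w~a)

  ∈N⇒¬∉N : ∀ {a w} → a ∈N[ w ] → ¬ a ∉N[ w ]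
  ∈N⇒¬∉N (inj₁ a≡w) (a≢w , _)  = a≢w a≡w
  ∈N⇒¬∉N (inj₂ w~a) (_ , ¬w~a) = ¬w~a w~a

  ≡true⇒~ : ∀ {a b} → adj a b ≡ true → a ~ b
  ≡true⇒~ eq = subst T (sym eq) _

  ≡false⇒≁ : ∀ {a b} → adj a b ≡ false → ¬ a ~ b
  ≡false⇒≁ = subst T

  ∉N-sym : ∀ {a w} → a ∉N[ w ] → w ∉N[ a ]
  ∉N-sym (a≢w , ¬w~a) = a≢w ∘ sym , ¬w~a ∘ ~-sym

  ~⇒≢ : ∀ {a b} → a ~ b → ¬ a ≡ b
  ~⇒≢ a~b refl = ~-irrefl a~b

  walk-snoc : ∀ {a b c k} → Walk adj a b k → b ~ c → Walk adj a c (suc k)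
  walk-snoc here      b~c = step b~c here
  walk-snoc (step e w) b~c = step e (walk-snoc w b~c)

  AW : Fin n → Fin n → Fin n → Set
  AW = AvoidWalk adj

  avoid-source : ∀ {w a b} → AW w a b → a ∉N[ w ]
  avoid-source (here a≢w ¬wa)     = a≢w , ¬wa
  avoid-source (step a≢w ¬wa _ _) = a≢w , ¬wa

  avoid-target : ∀ {w a b} → AW w a b → b ∉N[ w ]
  avoid-target (here b≢w ¬wb)  = b≢w , ¬wb
  avoid-target (step _ _ _ p) = avoid-target p

  avoid-here : ∀ {w a} → a ∉N[ w ] → AW w a a
  avoid-here (a≢w , ¬wa) = here a≢w ¬wa

  avoid-cons : ∀ {w a b c} → a ∉N[ w ] → a ~ b → AW w b c → AW w a c
  avoid-cons (a≢w , ¬wa) = step a≢w ¬wa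

  avoid-snoc : ∀ {w a b c} → AW w a b → b ~ c → c ∉N[ w ] → AW w a c
  avoid-snoc (here b≢w ¬wb)     b~c c∉ = step b≢w ¬wb b~c (avoid-here c∉)
  avoid-snoc (step a≢w ¬wa e p) b~c c∉ = step a≢w ¬wa e (avoid-snoc p b~c c∉)

  avoid-++ : ∀ {w a b c} → AW w a b → AW w b c → AW w a c
  avoid-++ (here _ _)         q = q
  avoid-++ (step a≢w ¬wa e p) q = step a≢w ¬wa e (avoid-++ p q)

  avoid-reverse : ∀ {w a b} → AW w a b → AW w b a
  avoid-reverse (here a≢w ¬wa)     = here a≢w ¬wa
  avoid-reverse (step a≢w ¬wa e p) = avoid-snoc (avoid-reverse p) (~-sym e) (a≢w , ¬wa)

  walk-reverse : ∀ {a b k} → Walk adj a b k → Walk adj b a k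
  walk-reverse here       = here
  walk-reverse (step e w) = walk-snoc (walk-reverse w) (~-sym e)

  -- Each vertex of the walk other than b is reached from a in fewer than d − 1 steps.
  walk-avoids : ∀ {a p b z t k d} → (∀ j → Walk adj a z j → d ≤ j) → Walk adj a p t → Walk adj p b k →
                t + k < d → b ∉N[ z ] → AW z p b
  walk-avoids a⇝z≥d a⇝p here t+0<d b∉ = avoid-here b∉
  walk-avoids {t = t} {suc k} {d} a⇝z≥d a⇝p (step p~c c⇝b) t+k<d b∉ =
    avoid-cons ((λ { refl → <⇒≱ t<d (a⇝z≥d t a⇝p) }) ,
                λ z~p → <⇒≱ t<d′ (a⇝z≥d (suc t) (walk-snoc a⇝p (~-sym z~p))))
      p~c (walk-avoids a⇝z≥d (walk-snoc a⇝p p~c) c⇝b (subst (_< d) (+-suc t k) t+k<d) b∉)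
    where
    t<d′ : suc t < d
    t<d′ = ≤-<-trans (subst (_≤ t + suc k) (+-comm t 1) (+-monoʳ-≤ t (s≤s z≤n))) t+k<d
    t<d = <-trans (n<1+n t) t<d′

  far-neighbourhoods : ∀ {y z d} → (∀ k → Walk adj y z k → d ≤ k) → 2 < d → ∀ c → c ∈N[ y ] → c ∉N[ z ]
  far-neighbourhoods {y} {z} {d} y⇝z≥d 2<d = outside
    where
    short : ∀ {k} → Walk adj y z k → k ≤ 2 → ⊥
    short y⇝z k≤2 = <⇒≱ 2<d (≤-trans (y⇝z≥d _ y⇝z) k≤2)
    outside : ∀ c → c ∈N[ y ] → c ∉N[ z ]
    outside c (inj₁ refl) = (λ y≡z → short (subst (λ v → Walk adj y v 0) y≡z here) z≤n) ,
                            λ z~y → short (step (~-sym z~y) here) (s≤s z≤n)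
    outside c (inj₂ y~c)  = (λ c≡z → short (step (subst (y ~_) c≡z y~c) here) (s≤s z≤n)) ,
                            λ z~c → short (step y~c (step (~-sym z~c) here)) ≤-refl

  IsWalk : ℕ → (ℕ → Fin n) → Set
  IsWalk m r = ∀ k → k < m → r k ~ r (suc k)

  IsWalk-extend : ∀ {m r c} → IsWalk m r → r m ~ c → IsWalk (suc m) (r [ suc m ↦ c ])
  IsWalk-extend {m} {r} {c} walk rm~c k k<1+m with m≤n⇒m<n∨m≡n (≤-pred k<1+m)
  ... | inj₁ k<m  = subst₂ _~_ (sym (update-≢ r (<⇒≢ (<-trans k<m (n<1+n m)))))
                      (sym (update-≢ r (<⇒≢ (s≤s k<m)))) (walk k k<m)
  ... | inj₂ refl = subst₂ _~_ (sym (update-≢ r (<⇒≢ (n<1+n k)))) (sym (update-≡ r (suc k))) rm~c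

  -- Follow a walk from u to y up to its first vertex in N[y].
  reach-avoiding : ∀ {u y z} → (∀ c → AW y c u → c ∉N[ z ]) → (∀ c → c ∈N[ y ] → c ∉N[ z ]) → AW z u y
  reach-avoiding {u} {y} {z} component∉ neighbourhood∉ = start (∉N-or-∈N u y) (Graph.connected G u y)
    where
    finish : ∀ {c} → AW z u c → c ∈N[ y ] → AW z u y
    finish u⇝c (inj₁ refl) = u⇝c
    finish u⇝c (inj₂ y~c)  = avoid-snoc u⇝c (~-sym y~c) (neighbourhood∉ y (inj₁ refl))
    along : ∀ {c k} → AW z u c → AW y c u → Walk adj c y k → AW z u y
    along u⇝c c⇝u here = ⊥-elim (proj₁ (avoid-source c⇝u) refl)
    along u⇝c c⇝u (step {c = c′} c~c′ c′⇝y) with ∉N-or-∈N c′ y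
    ... | inj₂ c′∈ = finish (avoid-snoc u⇝c c~c′ (neighbourhood∉ c′ c′∈)) c′∈
    ... | inj₁ c′∉ = along (avoid-snoc u⇝c c~c′ (component∉ c′ c′⇝u)) c′⇝u c′⇝y
      where c′⇝u = avoid-cons c′∉ (~-sym c~c′) c⇝u
    start : u ∉N[ y ] ⊎ u ∈N[ y ] → (∃ λ k → Walk adj u y k) → AW z u y
    start (inj₂ u∈) _         = finish (avoid-here (neighbourhood∉ u u∈)) u∈
    start (inj₁ u∉) (_ , u⇝y) = along (avoid-here (component∉ u (avoid-here u∉))) (avoid-here u∉) u⇝y

  skip-walk : ∀ {m d r} i → (∀ k → k < m + d → k < i ⊎ i + d < k → r k ~ r (suc k)) →
              r i ~ r (suc i + d) → IsWalk m (r ∘ skip i d)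
  skip-walk {m} {d} {r} i walk chord k k<m with <-cmp k i
  ... | tri< k<i _ _ rewrite skip-≤ {i} {d} (<⇒≤ k<i) | skip-≤ {i} {d} k<i =
    walk k (≤-trans k<m (m≤m+n m d)) (inj₁ k<i)
  ... | tri≈ _ refl _ rewrite skip-≤ {k} {d} ≤-refl | skip-> {k} {d} (n<1+n k) = chord
  ... | tri> _ _ i<k rewrite skip-> {i} {d} i<k | skip-> {i} {d} (m<n⇒m<1+n i<k) =
    walk (k + d) (+-monoˡ-< d k<m) (inj₂ (+-monoˡ-< d i<k))

  -- Replacing r (i + 1), …, r (i + d + 1) by the single vertex f.
  splice-walk : ∀ {m d r f} i → IsWalk (m + d) r → r i ~ f → f ~ r (suc (suc i + d)) →
                IsWalk m ((r [ suc i + d ↦ f ]) ∘ skip i d)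
  splice-walk {m} {d} {r} {f} i walk ri~f f~next = skip-walk i walk′ chord
    where
    j = suc i + d
    i<j : i < j
    i<j = s≤s (m≤m+n i d)
    chord : (r [ j ↦ f ]) i ~ (r [ j ↦ f ]) j
    chord = subst₂ _~_ (sym (update-≢ r (<⇒≢ i<j))) (sym (update-≡ r j)) ri~f
    walk′ : ∀ k → k < m + d → k < i ⊎ i + d < k → (r [ j ↦ f ]) k ~ (r [ j ↦ f ]) (suc k)
    walk′ k k<m+d (inj₁ k<i) = subst₂ _~_ (sym (update-≢ r (<⇒≢ (<-trans k<i i<j))))
                                 (sym (update-≢ r (<⇒≢ (≤-<-trans k<i i<j)))) (walk k k<m+d)
    walk′ k k<m+d (inj₂ j≤k) with m≤n⇒m<n∨m≡n j≤k
    ... | inj₁ j<k  = subst₂ _~_ (sym (update-≢ r (>⇒≢ j<k))) (sym (update-≢ r (>⇒≢ (m<n⇒m<1+n j<k))))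
                        (walk k k<m+d)
    ... | inj₂ refl = subst₂ _~_ (sym (update-≡ r j)) (sym (update-≢ r (>⇒≢ (n<1+n j)))) f~next

module VisitOrder {n : ℕ} (G : Graph n) (τ : Permutation′ n) where
  open Graph G using (adj)
  open GraphFacts G

  pos : Fin n → ℕ
  pos v = toℕ (τ ⟨$⟩ˡ v)

  pos-injective : ∀ {a b} → pos a ≡ pos b → a ≡ b
  pos-injective {a} {b} eq = begin
    a                          ≡⟨ inverseʳ τ ⟨
    τ ⟨$⟩ʳ (τ ⟨$⟩ˡ a)          ≡⟨ cong (τ ⟨$⟩ʳ_) (toℕ-injective eq) ⟩
    τ ⟨$⟩ʳ (τ ⟨$⟩ˡ b)          ≡⟨ inverseʳ τ ⟩
    b                          ∎
    where open ≡-Reasoning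

  pos<⇒≢ : ∀ {a b} → pos a < pos b → ¬ a ≡ b
  pos<⇒≢ a<b refl = <-irrefl refl a<b

  pos-cmp : ∀ {a b} → ¬ a ≡ b → pos a < pos b ⊎ pos b < pos a
  pos-cmp {a} {b} a≢b with <-cmp (pos a) (pos b)
  ... | tri< a<b _ _ = inj₁ a<b
  ... | tri≈ _ eq _  = ⊥-elim (a≢b (pos-injective eq))
  ... | tri> _ _ b<a = inj₂ b<a

  module _ {s : Fin n} (lexBFS : IsLexBFS adj s τ) where

    pos-start : pos s ≡ 0
    pos-start = begin
      pos s                    ≡⟨ cong pos (proj₁ lexBFS first (toℕ-fromℕ< 0<n)) ⟨
      toℕ (τ ⟨$⟩ˡ (τ ⟨$⟩ʳ first)) ≡⟨ cong toℕ (inverseˡ τ) ⟩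
      toℕ first                ≡⟨ toℕ-fromℕ< 0<n ⟩
      0                        ∎
      where
      0<n = ≤-<-trans z≤n (toℕ<n s)
      first = fromℕ< 0<n
      open ≡-Reasoning

    lexBFS-fourPoint : ∀ {a b c} → pos a < pos b → pos b < pos c → a ~ c → ¬ a ~ b →
                       ∃ λ d → pos d < pos a × d ~ b × ¬ d ~ c
    lexBFS-fourPoint {a} {b} {c} a<b b<c a~c ¬a~b
      with LabelOrder.lexBFS-fourPoint-steps adj τ lexBFS (τ ⟨$⟩ˡ a) (τ ⟨$⟩ˡ b) (τ ⟨$⟩ˡ c) a<b b<c
             (subst₂ _~_ (sym (inverseʳ τ)) (sym (inverseʳ τ)) a~c)
             (¬a~b ∘ subst₂ _~_ (inverseʳ τ) (inverseʳ τ))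
    ... | k , k<a , k~b , ¬k~c =
      τ ⟨$⟩ʳ k , subst (_< pos a) (sym (cong toℕ (inverseˡ τ))) k<a ,
      subst (τ ⟨$⟩ʳ k ~_) (inverseʳ τ) k~b , ¬k~c ∘ subst (τ ⟨$⟩ʳ k ~_) (sym (inverseʳ τ))

module LastVisited {n : ℕ} (G : Graph (suc n)) (τ : Permutation′ (suc n)) where
  open VisitOrder G τ

  last : Fin (suc n)
  last = τ ⟨$⟩ʳ fromℕ n

  pos-last : pos last ≡ n
  pos-last = trans (cong toℕ (inverseˡ τ)) (toℕ-fromℕ n)

  ≤-last : ∀ v → pos v ≤ pos last
  ≤-last v = subst (pos v ≤_) (sym pos-last) (s≤s⁻¹ (toℕ<n (τ ⟨$⟩ˡ v)))

  before-last : ∀ {v} → ¬ v ≡ last → pos v < pos last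
  before-last v≢last = ≤∧≢⇒< (≤-last _) (v≢last ∘ pos-injective)

  σ⁻¹-reverses : ∀ {x y} → σ⁻¹ (Graph.adj G) τ x < σ⁻¹ (Graph.adj G) τ y → pos y < pos x
  σ⁻¹-reverses x<y = ≰⇒> λ x≤y → <⇒≱ x<y (∸-monoʳ-≤ (suc n) x≤y)

-- The last vertex of LexBFS on an AT-free graph is admissible

Admissible : ∀ {n} → Graph n → Fin n → Set
Admissible G u = ∀ a b → AvoidWalk (Graph.adj G) b a u → ¬ AvoidWalk (Graph.adj G) a b u

module LexBFS-End {n : ℕ} (G : Graph (suc n)) {s : Fin (suc n)} (τ : Permutation′ (suc n))
                  (lexBFS : IsLexBFS (Graph.adj G) s τ) where
  open Graph G using (adj)
  open GraphFacts G
  open VisitOrder G τ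

  open LastVisited G τ renaming (last to u)

  module EarliestOfComponent {b k : Fin (suc n)} (b⇝k : AW u b k)
                             (earliest : ∀ c → pos c < pos k → ¬ AW u b c) where

    earlier-sees-k-as-u : ∀ {c} → pos c < pos k → adj c k ≡ adj c u
    earlier-sees-k-as-u {c} c<k with adj c k in ck | adj c u in cu
    ... | true  | true  = refl
    ... | false | false = refl
    ... | true  | false with c ≟ u
    ...   | yes refl = ⊥-elim (proj₂ (avoid-target b⇝k) (≡true⇒~ ck))
    ...   | no c≢u  = ⊥-elim (earliest c c<k
                        (avoid-snoc b⇝k (~-sym (≡true⇒~ ck)) (c≢u , ≡false⇒≁ cu ∘ ~-sym)))
    earlier-sees-k-as-u {c} c<k | false | true
      with lexBFS-fourPoint lexBFS c<k (before-last (proj₁ (avoid-target b⇝k))) (≡true⇒~ cu) (≡false⇒≁ ck)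
    ... | d , d<c , d~k , ¬d~u = ⊥-elim (earliest d (<-trans d<c c<k)
            (avoid-snoc b⇝k (~-sym d~k) ((λ { refl → proj₂ (avoid-target b⇝k) d~k }) , ¬d~u ∘ ~-sym)))

    -- Inducting on the earlier vertex: a vertex c before k that told v and u apart would, by the
    -- four-point condition, produce an even earlier vertex doing the same (for v or for k).
    earlier-sees-later-as-u : ∀ {v} → pos k ≤ pos v → ¬ v ≡ u → ∀ c → pos c < pos k → adj c v ≡ adj c u
    earlier-sees-later-as-u {v} k≤v v≢u = measure-rec pos (λ c → pos c < pos k → adj c v ≡ adj c u) induct
      where
      induct : ∀ c → (∀ d → pos d < pos c → pos d < pos k → adj d v ≡ adj d u) → pos c < pos k →
               adj c v ≡ adj c u
      induct c ih c<k with v ≟ k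
      ... | yes refl = earlier-sees-k-as-u c<k
      ... | no v≢k with adj c v in cv | adj c u in cu
      ...   | true  | true  = refl
      ...   | false | false = refl
      ...   | false | true
        with lexBFS-fourPoint lexBFS (<-≤-trans c<k k≤v) (before-last v≢u) (≡true⇒~ cu) (≡false⇒≁ cv)
      ...     | d , d<c , d~v , ¬d~u = ⊥-elim (¬d~u (subst T (ih d d<c (<-trans d<c c<k)) d~v))
      induct c ih c<k | no v≢k | true | false
        with lexBFS-fourPoint lexBFS c<k (≤∧≢⇒< k≤v (v≢k ∘ sym ∘ pos-injective)) (≡true⇒~ cv)
               (≡false⇒≁ cu ∘ subst T (earlier-sees-k-as-u c<k))
      ...     | d , d<c , d~k , ¬d~v = ⊥-elim (¬d~v (subst T (sym (ih d d<c d<k))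
                                           (subst T (earlier-sees-k-as-u d<k) d~k)))
        where d<k = <-trans d<c c<k

    no-crossing : ∀ {p q} → AW u p q → pos p < pos k → pos k ≤ pos q → ⊥
    no-crossing (here _ _) p<k k≤p = <⇒≱ p<k k≤p
    no-crossing {p} (step {c = c} _ ¬u~p p~c rest) p<k k≤q with pos k ≤? pos c
    ... | yes k≤c = ¬u~p (~-sym (subst T (earlier-sees-later-as-u k≤c (proj₁ (avoid-source rest)) p p<k) p~c))
    ... | no k≰c  = no-crossing rest (≰⇒> k≰c) k≤q

  refute-via-earliest : ∀ {b c} → AW u b c →
    (∀ {k} → AW u b k → (∀ c → pos c < pos k → ¬ AW u b c) → ⊥) → ⊥
  refute-via-earliest {b} {c} b⇝c absurd = no-minimal-counterexample pos (AW u b) (λ _ → absurd) c b⇝c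

  -- Compare the earliest vertices of the components of G − N[u] containing a and b: vertices before
  -- such an earliest vertex see every later vertex other than u the way they see u.
  sees-later-component : ∀ {a b a′ w} → pos a < pos b → b ∉N[ u ] → ¬ AW u a b →
                         AW u a a′ → a′ ~ w → u ~ w → w ~ b
  sees-later-component {a} {b} {a′} {w} a<b b∉ a≁b a⇝a′ a′~w u~w with w ~? b
  ... | yes w~b = w~b
  ... | no ¬w~b = ⊥-elim (refute-via-earliest (avoid-here b∉) in-component-of-b)
    where
    in-component-of-b : ∀ {kb} → AW u b kb → (∀ c → pos c < pos kb → ¬ AW u b c) → ⊥
    in-component-of-b {kb} b⇝kb earliest-kb = compare-w (pos w <? pos kb)
      where
      module B = EarliestOfComponent b⇝kb earliest-kb
      compare-w : Dec (pos w < pos kb) → ⊥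
      compare-w (yes w<kb) = ¬w~b (subst T (sym (B.earlier-sees-later-as-u kb≤b (proj₁ b∉) w w<kb)) (~-sym u~w))
        where kb≤b = ≮⇒≥ λ b<kb → earliest-kb b b<kb (avoid-here b∉)
      compare-w (no w≮kb) = refute-via-earliest a⇝a′ in-component-of-a
        where
        kb<w : pos kb < pos w
        kb<w = ≤∧≢⇒< (≮⇒≥ w≮kb) λ eq → proj₂ (avoid-target b⇝kb) (subst (u ~_) (sym (pos-injective eq)) u~w)
        in-component-of-a : ∀ {k} → AW u a k → (∀ c → pos c < pos k → ¬ AW u a c) → ⊥
        in-component-of-a {k} a⇝k earliest-k
          with pos-cmp {k} {kb} (λ { refl → a≁b (avoid-++ a⇝k (avoid-reverse b⇝kb)) })
        ... | inj₂ kb<k = EarliestOfComponent.no-crossing a⇝k earliest-k (avoid-reverse b⇝kb) kb<k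
                            (≤-trans (≮⇒≥ λ a<k → earliest-k a a<k (avoid-here (avoid-source a⇝k))) (<⇒≤ a<b))
        ... | inj₁ k<kb with pos a′ <? pos kb
        ...   | yes a′<kb = proj₂ (avoid-target a⇝a′)
                              (~-sym (subst T (B.earlier-sees-later-as-u (<⇒≤ kb<w) (~⇒≢ u~w ∘ sym) a′ a′<kb) a′~w))
        ...   | no a′≮kb = B.no-crossing (avoid-++ (avoid-reverse a⇝k) a⇝a′) k<kb (≮⇒≥ a′≮kb)

  module _ (atFree : ATFree adj) where

    private
      admissible-ordered : ∀ {a b} → pos a < pos b → AW b a u → ¬ AW a b u
      admissible-ordered {a} {b} a<b a⇝u b⇝u = along (avoid-here (∉N-sym (avoid-target b⇝u))) a⇝u
        where
        a≁b : ¬ AW u a b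
        a≁b a⇝b = atFree a b u (a⇝b , b⇝u , a⇝u)
        -- a⇝c is the part of the path from a walked so far; it stays in G − N[u].
        along : ∀ {c} → AW u a c → AW b c u → ⊥
        along a⇝c (here _ _) = proj₁ (avoid-target a⇝c) refl
        along a⇝c (step {c = c′} _ _ c~c′ rest) with c′ ≟ u | u ~? c′
        ... | yes refl | _        = proj₂ (avoid-target a⇝c) (~-sym c~c′)
        ... | no _     | yes u~c′ = proj₂ (avoid-source rest)
                                      (~-sym (sees-later-component a<b (∉N-sym (avoid-target a⇝u)) a≁b a⇝c c~c′ u~c′))
        ... | no c′≢u  | no ¬u~c′ = along (avoid-snoc a⇝c c~c′ (c′≢u , ¬u~c′)) rest

    lexBFS-end-admissible : Admissible G u
    lexBFS-end-admissible a b a⇝u b⇝u with pos-cmp (proj₁ (avoid-source a⇝u))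
    ... | inj₁ a<b = admissible-ordered a<b a⇝u b⇝u
    ... | inj₂ b<a = admissible-ordered b<a b⇝u a⇝u


-- LexBFS from an admissible vertex

module AdmissibleStart {n : ℕ} (G : Graph n) {u : Fin n} (τ : Permutation′ n)
                       (lexBFS : IsLexBFS (Graph.adj G) u τ) (admissible : Admissible G u) where
  open Graph G using (adj)
  open GraphFacts G
  open VisitOrder G τ

  nothing-before-u : ∀ {v} → ¬ pos v < pos u
  nothing-before-u {v} v<u = n≮0 (subst (pos v <_) (pos-start lexBFS) v<u)

  VisitedBefore : Fin n → Set
  VisitedBefore y = ∀ w → AW y w u → pos w < pos y

  weight : (ℕ → Fin n) → ℕ → ℕ
  weight r = sum≤ (pos ∘ r)

  weight-update : ∀ {m r j f} i → j ≤ m → pos f < pos (r j) → weight ((r [ j ↦ f ]) ∘ skip i 0) m < weight r m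
  weight-update {m} {r} {j} {f} i j≤m f<rj = sum≤-mono-< m pointwise j≤m at-j
    where
    pointwise : ∀ k → k ≤ m → pos ((r [ j ↦ f ]) (skip i 0 k)) ≤ pos (r k)
    pointwise k _ rewrite skip-0 i k with k ≟ℕ j
    ... | yes refl = <⇒≤ f<rj
    ... | no  _    = ≤-refl
    at-j : pos ((r [ j ↦ f ]) (skip i 0 j)) < pos (r j)
    at-j rewrite skip-0 i j | update-≡ r j {f} = f<rj

  module _ (y : Fin n) where

    record Escapes (m : ℕ) (r : ℕ → Fin n) : Set where
      field
        start  : r 0 ≡ u
        avoids : ∀ k → k ≤ m → r k ∉N[ y ]
        early  : ∀ k → k < m → pos (r k) < pos y
        late   : pos y < pos (r m)

    EscapeRoute : ℕ → (ℕ → Fin n) → Set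
    EscapeRoute m r = IsWalk m r × Escapes m r

    escapes-skip : ∀ {m d r} i → i < m → Escapes (m + d) r → Escapes m (r ∘ skip i d)
    escapes-skip {m} {d} {r} i i<m esc = record
      { start  = trans (cong r (skip-≤ {i} {d} z≤n)) start
      ; avoids = λ k k≤m → avoids (skip i d k) (≤-trans (skip-≤-+ i d k) (+-monoˡ-≤ d k≤m))
      ; early  = λ k k<m → early (skip i d k) (≤-<-trans (skip-≤-+ i d k) (+-monoˡ-< d k<m))
      ; late   = subst (λ l → pos y < pos (r l)) (sym (skip-> i<m)) late
      }
      where open Escapes esc

    escapes-update : ∀ {m r j f} → 0 < j → j < m → f ∉N[ y ] → pos f < pos y →
                     Escapes m r → Escapes m (r [ j ↦ f ])
    escapes-update {m} {r} {j} {f} 0<j j<m f∉ f<y esc = record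
      { start  = trans (update-≢ r (<⇒≢ 0<j)) start
      ; avoids = λ k k≤m → update-elim {P = _∉N[ y ]} r k (λ _ → avoids k k≤m) f∉
      ; early  = λ k k<m → update-elim {P = λ v → pos v < pos y} r k (λ _ → early k k<m) f<y
      ; late   = subst (λ v → pos y < pos v) (sym (update-≢ r (>⇒≢ j<m))) late
      }
      where open Escapes esc

    shortcut-route : ∀ {m d r} i → i < m → EscapeRoute (m + d) r → r i ~ r (suc i + d) →
                     EscapeRoute m (r ∘ skip i d)
    shortcut-route i i<m (walk , esc) chord =
      skip-walk i (λ k k<m+d _ → walk k k<m+d) chord , escapes-skip i i<m esc

    splice-route : ∀ {m d r f} i → suc i < m → EscapeRoute (m + d) r → r i ~ f → f ~ r (suc (suc i + d)) →
                   f ∉N[ y ] → pos f < pos y → EscapeRoute m ((r [ suc i + d ↦ f ]) ∘ skip i d)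
    splice-route {d = d} i 1+i<m (walk , esc) ri~f f~next f∉ f<y =
      splice-walk i walk ri~f f~next ,
      escapes-skip i (<-trans (n<1+n i) 1+i<m) (escapes-update z<s (+-monoˡ-< d 1+i<m) f∉ f<y esc)

    escape-route : ∀ {m r a w} → r 0 ≡ u → IsWalk m r → (∀ k → k ≤ m → r k ∉N[ y ] × pos (r k) < pos y) →
                   r m ≡ a → AW y a w → pos y < pos w → ∃ λ m → ∃ (EscapeRoute m)
    escape-route {m} _ _ prefix refl (here _ _) y<w = ⊥-elim (<-asym y<w (proj₂ (prefix m ≤-refl)))
    escape-route {m} {r} r0 walk prefix refl (step {c = c} _ _ rm~c c⇝w) y<w = extend (pos c <? pos y)
      where
      r′ = r [ suc m ↦ c ]
      c∉ = avoid-source c⇝w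
      r′0 : r′ 0 ≡ u
      r′0 = trans (update-≢ r {suc m} {c} λ ()) r0
      walk′ : IsWalk (suc m) r′
      walk′ = IsWalk-extend walk rm~c
      extend : Dec (pos c < pos y) → ∃ λ m → ∃ (EscapeRoute m)
      extend (yes c<y) = escape-route r′0 walk′ (update-∀≤ {P = λ v → v ∉N[ y ] × pos v < pos y} prefix (c∉ , c<y))
                           (update-≡ r (suc m)) c⇝w y<w
      extend (no c≮y)  = suc m , r′ , walk′ , record
        { start  = r′0
        ; avoids = update-∀≤ {P = _∉N[ y ]} (λ k → proj₁ ∘ prefix k) c∉
        ; early  = λ k k<1+m → subst (λ v → pos v < pos y) (sym (update-≢ r (<⇒≢ k<1+m)))
                                 (proj₂ (prefix k (≤-pred k<1+m)))
        ; late   = subst (λ v → pos y < pos v) (sym (update-≡ r (suc m)))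
                     (≤∧≢⇒< (≮⇒≥ c≮y) λ eq → proj₁ c∉ (sym (pos-injective eq)))
        }

  module MinimalEscape (y : Fin n)
      (visited-before-y : ∀ y′ → pos y′ < pos y → VisitedBefore y′)
      {m : ℕ} {r : ℕ → Fin n} (route : EscapeRoute y m r)
      (shorter : ∀ m′ → m′ < m → ∀ r′ → ¬ EscapeRoute y m′ r′)
      (lighter : ∀ r′ → weight r′ m < weight r m → ¬ EscapeRoute y m r′) where

    open Escapes (proj₂ route)

    walk : IsWalk m r
    walk = proj₁ route

    prefix-avoiding : ∀ {z i} → i ≤ m → (∀ k → k ≤ i → r k ∉N[ z ]) → AW z (r i) u
    prefix-avoiding {z} {zero}  _   out = subst (AW z (r 0)) start (avoid-here (out 0 z≤n))
    prefix-avoiding {z} {suc i} i<m out = avoid-cons (out (suc i) ≤-refl) (~-sym (walk i i<m))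
                                            (prefix-avoiding (<⇒≤ i<m) λ k → out k ∘ m≤n⇒m≤1+n)

    -- Since f is visited before y, induction on y forbids r i to reach u avoiding N[f].
    touches : ∀ {f i} → pos f < pos y → pos f < pos (r i) → i ≤ m → ∃ λ k → k ≤ i × r k ∈N[ f ]
    touches {f} {i} f<y f<ri i≤m with bounded-all-or-any _ _ (λ k → ∉N-or-∈N (r k) f) i
    ... | inj₁ out = ⊥-elim (<-asym f<ri (visited-before-y f f<y (r i) (prefix-avoiding i≤m out)))
    ... | inj₂ hit = hit

    route-∸ : ∀ {d} → d ≤ m → EscapeRoute y (m ∸ d + d) r
    route-∸ d≤m = subst (λ l → EscapeRoute y l r) (sym (m∸n+n≡m d≤m)) route

    no-chord : ∀ {i t} → suc i < t → t ≤ m → ¬ r i ~ r t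
    no-chord {i} {t} 1+i<t t≤m ri~rt =
      shorter (m ∸ d) (∸-monoʳ-< (m<n⇒0<n∸m 1+i<t) d≤m) (r ∘ skip i d)
        (shortcut-route y i (m+n≤o⇒m≤o∸n (suc i) (subst (_≤ m) (sym t≡) t≤m)) (route-∸ d≤m)
           (subst (λ l → r i ~ r l) (sym t≡) ri~rt))
      where
      d = t ∸ suc i
      t≡ : suc i + d ≡ t
      t≡ = m+[n∸m]≡n (<⇒≤ 1+i<t)
      d≤m : d ≤ m
      d≤m = ≤-trans (m∸n≤m t (suc i)) t≤m

    distinct : ∀ {k t} → k < t → t ≤ m → ¬ r k ≡ r t
    distinct {k} {t} k<t t≤m rk≡rt with m≤n⇒m<n∨m≡n t≤m
    ... | inj₂ refl = <-asym (early k k<t) (subst (λ v → pos y < pos v) (sym rk≡rt) late)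
    ... | inj₁ t<m with m≤n⇒m<n∨m≡n k<t
    ...   | inj₂ refl  = ~-irrefl (subst (_~ r t) rk≡rt (walk k (<-trans (n<1+n k) t<m)))
    ...   | inj₁ 1+k<t = no-chord (m<n⇒m<1+n 1+k<t) t<m (subst (_~ r (suc t)) (sym rk≡rt) (walk t t<m))

    later-avoids-prefix : ∀ {k t} → suc k < t → t ≤ m → r k ∉N[ r t ]
    later-avoids-prefix 1+k<t t≤m = distinct (<-trans (n<1+n _) 1+k<t) t≤m , no-chord 1+k<t t≤m ∘ ~-sym

    blocked : ∀ {j} → j ≤ m → ¬ AW (r j) y u
    blocked {j} j≤m y⇝u with m≤n⇒m<n∨m≡n j≤m
    ... | inj₁ j<m  = <-asym (early j j<m) (visited-before-y (r j) (early j j<m) y y⇝u)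
    ... | inj₂ refl = admissible (r m) y (prefix-avoiding ≤-refl avoids) y⇝u

    no-splice : ∀ {k d f} → suc (suc k + d) ≤ m → r k ~ f → f ~ r (suc (suc k + d)) → f ∉N[ y ] →
                pos f < pos y → pos f < pos (r (suc k + d)) → ⊥
    no-splice {k} {zero} bound rk~f f~next f∉ f<y f<rk+1 =
      lighter _ (weight-update k (<⇒≤ bound) f<rk+1)
        (splice-route y k (m+n≤o⇒m≤o (suc (suc k)) bound)
          (subst (λ l → EscapeRoute y l r) (sym (+-identityʳ m)) route) rk~f f~next f∉ f<y)
    no-splice {k} {suc d} bound rk~f f~next f∉ f<y _ =
      shorter (m ∸ suc d) (∸-monoʳ-< z<s d≤m) _
        (splice-route y k (m+n≤o⇒m≤o∸n (suc (suc k)) bound) (route-∸ d≤m) rk~f f~next f∉ f<y)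
      where
      d≤m : suc d ≤ m
      d≤m = ≤-trans (m≤n+m (suc d) (suc (suc k))) bound

    record FirstContact (g : Fin n) (j : ℕ) : Set where
      field
        j<m            : j < m
        g~y            : g ~ y
        g~rj           : g ~ r j
        g≁next         : ¬ g ~ r (suc j)
        g<rj           : pos g < pos (r j)
        prefix-before  : ∀ i → i < j → pos (r i) < pos g
        prefix-outside : ∀ i → i < j → r i ∉N[ g ]

    first-contact : ∀ {f j} → j < m → f ~ y → ¬ f ~ r (suc j) → pos f < pos (r j) → FirstContact f j
    first-contact {f} {j} j<m f~y f≁next f<rj = record
      { j<m = j<m ; g~y = f~y ; g~rj = contact ; g≁next = f≁next ; g<rj = f<rj
      ; prefix-before  = λ i i<j → visited-before-y f f<y (r i)
                           (prefix-avoiding (i≤m i<j) λ k k≤i → outside k (≤-<-trans k≤i i<j))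
      ; prefix-outside = outside
      }
      where
      f<y : pos f < pos y
      f<y = <-trans f<rj (early j j<m)
      i≤m : ∀ {i} → i < j → i ≤ m
      i≤m i<j = <⇒≤ (<-trans i<j j<m)
      f∉ : f ∉N[ r (suc j) ]
      f∉ = (λ f≡ → proj₂ (avoids (suc j) j<m) (subst (y ~_) f≡ (~-sym f~y))) , f≁next ∘ ~-sym
      -- otherwise y, f, r i, …, r 0 = u avoids N[r (j + 1)]
      outside : ∀ i → i < j → r i ∉N[ f ]
      outside i i<j with ∉N-or-∈N (r i) f
      ... | inj₁ ri∉         = ri∉
      ... | inj₂ (inj₁ ri≡f) = ⊥-elim (proj₂ (avoids i (i≤m i<j)) (subst (y ~_) (sym ri≡f) (~-sym f~y)))
      ... | inj₂ (inj₂ f~ri) = ⊥-elim (blocked j<m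
              (avoid-cons (∉N-sym (avoids (suc j) j<m)) (~-sym f~y)
                (avoid-cons f∉ f~ri (prefix-avoiding (i≤m i<j)
                  λ k k≤i → later-avoids-prefix (s≤s (≤-<-trans k≤i i<j)) j<m))))
      contact : f ~ r j
      contact with touches f<y f<rj (<⇒≤ j<m)
      ... | k , k≤j , rk∈ with m≤n⇒m<n∨m≡n k≤j
      ...   | inj₁ k<j  = ⊥-elim (∈N⇒¬∉N rk∈ (outside k k<j))
      ...   | inj₂ refl = [ (λ rj≡f → ⊥-elim (pos<⇒≢ f<rj (sym rj≡f))) , id ]′ rk∈

    descend : ∀ {g j} → FirstContact g (suc j) → ∃ λ f → pos f < pos (r j) × f ~ g × ¬ f ~ r (suc j)
    descend {g} {j} c = lexBFS-fourPoint lexBFS (prefix-before j ≤-refl) g<rj (walk j (<-trans (n<1+n j) j<m))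
                          (proj₂ (prefix-outside j ≤-refl) ∘ ~-sym)
      where open FirstContact c

    -- If f is not adjacent to y, either y, g, f, r k, …, r 0 avoids N[r (j + 2)], or f can replace
    -- r (k + 1), …, r (j + 1) on the route.
    bypass : ∀ {g j f} → FirstContact g (suc j) → pos f < pos (r j) → f ~ g → ¬ f ~ r (suc j) → ¬ f ~ y → ⊥
    bypass {g} {j} {f} c f<rj f~g f≁rj+1 ¬f~y = through (touches f<y f<rj (<⇒≤ j+1<m)) (f ~? x)
      where
      open FirstContact c
      x = r (suc (suc j))
      j+1<m = <-trans (n<1+n j) j<m
      f<y : pos f < pos y
      f<y = <-trans f<rj (early j j+1<m)
      y∉ : y ∉N[ x ]
      y∉ = ∉N-sym (avoids (suc (suc j)) j<m)
      g∉ : g ∉N[ x ]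
      g∉ = (λ g≡x → proj₂ (avoids (suc (suc j)) j<m) (subst (y ~_) g≡x (~-sym g~y))) , g≁next ∘ ~-sym
      through : (∃ λ k → k ≤ j × r k ∈N[ f ]) → Dec (f ~ x) → ⊥
      through (k , k≤j , rk∈) (no ¬f~x) = blocked j<m (avoid-cons y∉ (~-sym g~y) (g⇝u rk∈))
        where
        rk⇝u : AW x (r k) u
        rk⇝u = prefix-avoiding (≤-trans k≤j (<⇒≤ j+1<m))
                 λ i i≤k → later-avoids-prefix (s≤s (s≤s (≤-trans i≤k k≤j))) j<m
        f∉ : f ∉N[ x ]
        f∉ = (λ f≡x → g≁next (subst (g ~_) f≡x (~-sym f~g))) , ¬f~x ∘ ~-sym
        g⇝u : r k ∈N[ f ] → AW x g u
        g⇝u (inj₁ rk≡f) = avoid-cons g∉ (subst (g ~_) (sym rk≡f) (~-sym f~g)) rk⇝u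
        g⇝u (inj₂ f~rk) = avoid-cons g∉ (~-sym f~g) (avoid-cons f∉ f~rk rk⇝u)
      through (k , k≤j , inj₁ rk≡f) (yes f~x) = no-chord (s≤s (s≤s k≤j)) j<m (subst (_~ x) (sym rk≡f) f~x)
      through (k , k≤j , inj₂ f~rk) (yes f~x) =
        no-splice (subst (_≤ m) (sym j+2≡) j<m) (~-sym f~rk) (subst (λ l → f ~ r l) (sym j+2≡) f~x)
          (pos<⇒≢ f<y , ¬f~y ∘ ~-sym) f<y
          (subst (λ l → pos f < pos (r l)) (sym (cong (λ l → suc l) k+d≡j))
             (<-trans f<rj (<-trans (prefix-before j ≤-refl) g<rj)))
        where
        k+d≡j : k + (j ∸ k) ≡ j
        k+d≡j = m+[n∸m]≡n k≤j
        j+2≡ : suc (suc k + (j ∸ k)) ≡ suc (suc j)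
        j+2≡ = cong (λ l → suc (suc l)) k+d≡j

    no-first-contact : ∀ j {g} → ¬ FirstContact g j
    no-first-contact zero    c = nothing-before-u (subst (λ v → pos _ < pos v) start (FirstContact.g<rj c))
    no-first-contact (suc j) c with descend c
    ... | f , f<rj , f~g , f≁rj+1 with f ~? y
    ...   | yes f~y = no-first-contact j (first-contact (<-trans (n<1+n j) (FirstContact.j<m c)) f~y f≁rj+1 f<rj)
    ...   | no ¬f~y = bypass c f<rj f~g f≁rj+1 ¬f~y

  no-minimal-escape : ∀ y → (∀ y′ → pos y′ < pos y → VisitedBefore y′) →
    ∀ {m r} → EscapeRoute y m r → (∀ m′ → m′ < m → ∀ r′ → ¬ EscapeRoute y m′ r′) →
    (∀ r′ → weight r′ m < weight r m → ¬ EscapeRoute y m r′) → ⊥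
  no-minimal-escape y ih {zero} (_ , esc) _ _ =
    nothing-before-u (subst (λ v → pos y < pos v) (Escapes.start esc) (Escapes.late esc))
  no-minimal-escape y ih {suc m} {r} route shorter lighter = from-separator
    (lexBFS-fourPoint lexBFS (early m ≤-refl) late (walk m ≤-refl) (proj₂ (avoids m (n≤1+n m)) ∘ ~-sym))
    where
    open MinimalEscape y ih route shorter lighter
    open Escapes (proj₂ route)
    from-separator : (∃ λ d → pos d < pos (r m) × d ~ y × ¬ d ~ r (suc m)) → ⊥
    from-separator (d , d<rm , d~y , d≁last) = no-first-contact m (first-contact ≤-refl d~y d≁last d<rm)

  no-escape-route : ∀ y → (∀ y′ → pos y′ < pos y → VisitedBefore y′) → ∀ m r → ¬ EscapeRoute y m r
  no-escape-route y ih = measure-rec id (λ m → ∀ r → ¬ EscapeRoute y m r) λ m shorter →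
    no-minimal-counterexample (λ r → weight r m) (EscapeRoute y m) λ r route lighter →
      no-minimal-escape y ih route shorter lighter

  u-first : ∀ {y} → ¬ u ≡ y → pos u < pos y
  u-first u≢y = subst (_< _) (sym (pos-start lexBFS))
    (n≢0⇒n>0 λ y≡0 → u≢y (pos-injective (trans (pos-start lexBFS) (sym y≡0))))

  visited-before : ∀ y → VisitedBefore y
  visited-before = measure-rec pos VisitedBefore induct
    where
    induct : ∀ y → (∀ y′ → pos y′ < pos y → VisitedBefore y′) → VisitedBefore y
    induct y ih w w⇝u with pos w <? pos y
    ... | yes w<y = w<y
    ... | no  w≮y = ⊥-elim (no-escape-route y ih _ _ (proj₂ (proj₂ escape)))
      where
      u∉ = avoid-target w⇝u
      escape = escape-route y {0} {λ _ → u} refl (λ _ ()) (λ { .0 z≤n → u∉ , u-first (proj₁ u∉) }) refl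
                 (avoid-reverse w⇝u) (≤∧≢⇒< (≮⇒≥ w≮y) λ eq → proj₁ (avoid-source w⇝u) (sym (pos-injective eq)))

  -- N[z] misses the component of u in G − N[y], which cannot contain x.
  reaching-y-before-z : ∀ {x y z} → pos y < pos x → AW y x z → (∀ c → c ∈N[ y ] → c ∉N[ z ]) →
                        ∀ w → AW z w y → pos w < pos z
  reaching-y-before-z {x} {y} {z} y<x x⇝z N[y]∉ w w⇝y =
    visited-before z w (avoid-++ w⇝y (avoid-reverse (reach-avoiding component∉ N[y]∉)))
    where
    component∉ : ∀ c → AW y c u → c ∉N[ z ]
    component∉ c c⇝u with ∉N-or-∈N c z
    ... | inj₁ c∉ = c∉
    ... | inj₂ c∈ = ⊥-elim (<-asym y<x (visited-before y x (avoid-++ x⇝z (z⇝u c∈))))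
      where
      z⇝u : c ∈N[ z ] → AW y z u
      z⇝u (inj₁ c≡z) = subst (λ v → AW y v u) c≡z c⇝u
      z⇝u (inj₂ z~c) = avoid-cons (avoid-target x⇝z) z~c c⇝u

lemma5 : ∀ {n : ℕ} (G : Graph (suc n)) → ATFree (Graph.adj G) →
    ∀ (s : Fin (suc n)) (τ₀ : Permutation′ (suc n)) → IsLexBFS (Graph.adj G) s τ₀ →
    ∀ (τ : Permutation′ (suc n)) → IsLexBFS (Graph.adj G) (τ₀ ⟨$⟩ʳ fromℕ n) τ →
    ∀ (x y : Fin (suc n)) (i : ℕ) →
    ¬ E (Graph.adj G) x y →
    IsDist (Graph.adj G) (τ ⟨$⟩ʳ fromℕ n) x i →
    IsDist (Graph.adj G) (τ ⟨$⟩ʳ fromℕ n) y i →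
    σ⁻¹ (Graph.adj G) τ x < σ⁻¹ (Graph.adj G) τ y →
    ∀ (z : Fin (suc n)) (dz : ℕ) → IsDist (Graph.adj G) (τ ⟨$⟩ʳ fromℕ n) z dz → i < dz →
    ∀ (dxz dyz : ℕ) → IsDist (Graph.adj G) x z dxz → IsDist (Graph.adj G) y z dyz →
    dyz ≤ dxz ⊔ 2
lemma5 G atFree s τ₀ lexBFS₀ τ lexBFS x y i x≁y _ dist-vy x-before-y z dz dist-vz i<dz dxz dyz dist-xz dist-yz
  with dyz ≤? dxz ⊔ 2
... | yes close = close
... | no  far   = ⊥-elim (<⇒≱ (reaching-y-before-z y<x x⇝z N[y]∉N[z] last v⇝y) (≤-last z))
  where
  open GraphFacts G
  open VisitOrder G τ
  open LastVisited G τ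
  open AdmissibleStart G τ lexBFS (LexBFS-End.lexBFS-end-admissible G τ₀ lexBFS₀ atFree)
  y<x : pos y < pos x
  y<x = σ⁻¹-reverses x-before-y
  N[y]∉N[z] : ∀ c → c ∈N[ y ] → c ∉N[ z ]
  N[y]∉N[z] = far-neighbourhoods (proj₂ dist-yz) (≤-<-trans (m≤n⊔m dxz 2) (≰⇒> far))
  x⇝z : AW y x z
  x⇝z = avoid-reverse (walk-avoids (λ k → proj₂ dist-yz k ∘ walk-reverse) here (walk-reverse (proj₁ dist-xz))
          (≤-<-trans (m≤m⊔n dxz 2) (≰⇒> far)) (pos<⇒≢ y<x ∘ sym , x≁y ∘ ~-sym))
  v⇝y : AW z last y
  v⇝y = walk-avoids (proj₂ dist-vz) here (proj₁ dist-vy) i<dz (N[y]∉N[z] y (inj₁ refl))
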